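{- Let $k\ge 2$ and let $d:\chi^2\to[0,\infty)$ be a metric on a set $\chi$. For $p_1,\ldots,p_k\in\chi$, let $Q=elem(\{p_1,\ldots,p_k\})$ and define $d_{\mathrm{HC}}(p_1,\ldots,p_k)$ to be the minimum cost of a Hamiltonian circuit on $Q$ with respect to $d$, i.e. the minimum over all cyclic orderings $(q_1,\ldots,q_t)$ of the $t=|Q|$ elements of $Q$ of $\sum_{s=1}^{t-1}d(q_s,q_{s+1})+d(q_t,q_1)$ (so the value is $0$ if $t=1$ and $2d(q_1,q_2)$ if $t=2$). Then $d_{\mathrm{HC}}:\chi^k\to[0,\infty)$ is an $H$-metric with parameter $\gamma=1$.
   Context: For a multiset $S$ of elements of $\chi$, $elem(S)$ denotes the set of distinct elements of $S$. A function $d_H:\chi^k\to[0,\infty)$ is an $H$-metric with parameter $\gamma$ (an integer with $\gamma\le k-1$) if it satisfies: ($\Pi$) $d_H(p_1,\ldots,p_k)=d_H(p_{\pi(1)},\ldots,p_{\pi(k)})$ for every permutation $\pi$ of $\{1,\dots,k\}$; ($O_D$) $d_H(p_1,\ldots,p_k)\ge 0$, with equality if and only if $p_1=\cdots=p_k$; ($\Delta_H$) for all $p_1,\ldots,p_k,a\in\chi$ and every $i\in\{1,\ldots,k\}$: $d_H(p_1,\ldots,p_k)\le d_H(p_1,\ldots,p_i,a,\ldots,a)+d_H(a,\ldots,a,p_{i+1},\ldots,p_k)$, where $a$ is repeated $k-i$ times in the first term and $i$ times in the second; ($\mathcal S_H$) for all $p_1,\ldots,p_k,p'_1,\ldots,p'_k\in\chi$: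 $d_H(p_1,\ldots,p_k)\le d_H(p'_1,\ldots,p'_k)$ if $elem(\{p_1,\ldots,p_k\})\subset elem(\{p'_1,\ldots,p'_k\})$ (proper inclusion), and $d_H(p_1,\ldots,p_k)\le\gamma\, d_H(p'_1,\ldots,p'_k)$ if $elem(\{p_1,\ldots,p_k\})= elem(\{p'_1,\ldots,p'_k\})$. -}

module Defs where

open import Level using (0ℓ)
open import Data.Nat using (ℕ; zero; suc; _∸_; _<?_) renaming (_≤_ to _≤ℕ_)
open import Data.Fin using (Fin; toℕ)
open import Data.Fin.Permutation using (Permutation′; _⟨$⟩ʳ_)
open import Data.List using (List; []; _∷_)
open import Data.List.Membership.Propositional using (_∈_)
open import Data.List.Relation.Unary.Unique.Propositional using (Unique)
open import Data.Product using (Σ; ∃; ∃-syntax; _×_; _,_)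
open import Relation.Nullary using (¬_; yes; no)
open import Relation.Binary.PropositionalEquality using (_≡_; _≢_)
open import Algebra.Structures using (IsCommutativeRing)
open import Relation.Binary.Structures using (IsTotalOrder)
open import Function.Bundles using (_⇔_)

-- The real numbers, axiomatised as a complete ordered field
-- (any two models are isomorphic, so quantifying over all models is
-- the same as talking about ℝ).

record RealField : Set₁ where
  infixl 6 _+_
  infixl 7 _*_
  infix 4 _≤_
  field
    Carrier : Set
    _+_ _*_ : Carrier → Carrier → Carrier
    -_ : Carrier → Carrier
    0# 1# : Carrier
    _≤_ : Carrier → Carrier → Set
    isCommutativeRing : IsCommutativeRing _≡_ _+_ _*_ -_ 0# 1#
    0≢1 : 0# ≢ 1#
    inverse : ∀ x → x ≢ 0# → ∃[ y ] (x * y ≡ 1#)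
    isTotalOrder : IsTotalOrder _≡_ _≤_
    +-monoˡ-≤ : ∀ {x y} z → x ≤ y → x + z ≤ y + z
    *-nonneg : ∀ {x y} → 0# ≤ x → 0# ≤ y → 0# ≤ x * y
    complete : (P : Carrier → Set) → ∃ P →
               (∃[ b ] (∀ x → P x → x ≤ b)) →
               ∃[ s ] ((∀ x → P x → x ≤ s) ×
                       (∀ b → (∀ x → P x → x ≤ b) → s ≤ b))

module _ (ℝ : RealField) where
  open RealField ℝ

  _·_ : ℕ → Carrier → Carrier
  zero · x = 0#
  suc n · x = x + (n · x)

  record IsMetric {χ : Set} (d : χ → χ → Carrier) : Set where
    field
      nonneg   : ∀ x y → 0# ≤ d x y
      zero⇔eq  : ∀ x y → (d x y ≡ 0#) ⇔ (x ≡ y)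
      sym      : ∀ x y → d x y ≡ d y x
      triangle : ∀ x y z → d x z ≤ d x y + d y z

  _⊆ₑ_ : {χ : Set} {k : ℕ} → (Fin k → χ) → (Fin k → χ) → Set
  p ⊆ₑ p' = ∀ x → (∃[ j ] (p j ≡ x)) → ∃[ j ] (p' j ≡ x)

  _⊂ₑ_ : {χ : Set} {k : ℕ} → (Fin k → χ) → (Fin k → χ) → Set
  p ⊂ₑ p' = (p ⊆ₑ p') × ∃[ x ] ((∃[ j ] (p' j ≡ x)) × ¬ (∃[ j ] (p j ≡ x)))

  prefixThen : {χ : Set} {k : ℕ} → ℕ → (Fin k → χ) → χ → (Fin k → χ)
  prefixThen i p a j with toℕ j <? i
  ... | yes _ = p j
  ... | no  _ = a

  thenSuffix : {χ : Set} {k : ℕ} → ℕ → χ → (Fin k → χ) → (Fin k → χ)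
  thenSuffix i a p j with toℕ j <? i
  ... | yes _ = a
  ... | no  _ = p j

  record IsHMetric {χ : Set} (k γ : ℕ) (dH : (Fin k → χ) → Carrier) : Set where
    field
      γ≤k-1   : γ ≤ℕ k ∸ 1
      perm    : ∀ (π : Permutation′ k) (p : Fin k → χ) →
                dH p ≡ dH (λ j → p (π ⟨$⟩ʳ j))
      nonneg  : ∀ p → 0# ≤ dH p
      zero⇔eq : ∀ p → (dH p ≡ 0#) ⇔ (∀ i j → p i ≡ p j)
      triangle : ∀ (p : Fin k → χ) (a : χ) (i : ℕ) → 1 ≤ℕ i → i ≤ℕ k →
                 dH p ≤ dH (prefixThen i p a) + dH (thenSuffix i a p)
      mono⊂   : ∀ p p' → p ⊂ₑ p' → dH p ≤ dH p'
      mono≡   : ∀ p p' → p ⊆ₑ p' → p' ⊆ₑ p → dH p ≤ γ · dH p'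

  module _ {χ : Set} (d : χ → χ → Carrier) where
    lastOf : χ → List χ → χ
    lastOf x [] = x
    lastOf x (y ∷ ys) = lastOf y ys

    pathCost : χ → List χ → Carrier
    pathCost x [] = 0#
    pathCost x (y ∷ ys) = d x y + pathCost y ys

    circuitCost : List χ → Carrier
    circuitCost [] = 0#
    circuitCost (q ∷ qs) = pathCost q qs + d (lastOf q qs) q

    IsOrderingOf : {k : ℕ} → (Fin k → χ) → List χ → Set
    IsOrderingOf p L = Unique L × (∀ x → (x ∈ L) ⇔ (∃[ j ] (p j ≡ x)))

    IsMinHC : {k : ℕ} → (Fin k → χ) → Carrier → Set
    IsMinHC p v = (∃[ L ] (IsOrderingOf p L × circuitCost L ≡ v))
                × (∀ L → IsOrderingOf p L → v ≤ circuitCost L)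

-- By the triangle inequality, deleting vertices from a closed walk does not
-- increase its cost, so d_HC(p) is at most the cost of any closed walk through
-- all the pⱼ.  Applied to an optimal circuit on elem(p') ⊇ elem(p), this makes
-- d_HC monotone under inclusion of element sets, which yields (Π) and both
-- parts of (S_H) with γ = 1.  For (Δ_H), optimal circuits on the elements of
-- (p₁,…,pᵢ,a,…,a) and (a,…,a,p_{i+1},…,p_k) both pass through a; rotated to
-- start at a and concatenated, they form a closed walk through every pⱼ whose
-- cost is the right-hand side.  (O_D) holds because a circuit on two or more
-- distinct points has an edge of positive length.
module Submission where

open import Defs
open import Data.Nat using (ℕ; _≤_)
open import Data.Fin using (Fin)

open import Level using (_⊔_)
open import Data.Nat using (_<_; _<?_)
open import Data.Nat.Properties using (<-irrefl; <-≤-trans; <⇒≤; m≤n⇒m<n∨m≡n; ∸-monoˡ-≤)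
open import Data.Fin using (toℕ; fromℕ<)
open import Data.Fin.Properties using (toℕ<n; toℕ-fromℕ<)
open import Data.Fin.Permutation using (Permutation′; _⟨$⟩ʳ_; _⟨$⟩ˡ_; inverseʳ)
open import Data.List using (List; []; _∷_; _++_)
open import Data.List.Properties using (++-identityʳ)
open import Data.List.Membership.Propositional using (_∈_; _∉_)
open import Data.List.Membership.Propositional.Properties using (∈-∃++; ∈-++⁺ˡ; ∈-++⁺ʳ; ∈-++⁻)
open import Data.List.Relation.Unary.Any using (here; there)
open import Data.List.Relation.Unary.All as All using ()
open import Data.List.Relation.Unary.AllPairs using ([]; _∷_)
open import Data.List.Relation.Unary.Unique.Propositional using (Unique)
open import Data.List.Relation.Binary.Sublist.Propositional using (_⊆_; []; _∷_; _∷ʳ_; lookup)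
open import Data.List.Relation.Binary.Permutation.Propositional using (_↭_; ↭-sym)
open import Data.List.Relation.Binary.Permutation.Propositional.Properties using (∈-resp-↭; ++-comm)
open import Data.Product using (∃-syntax; _×_; _,_; proj₁; proj₂)
open import Data.Sum as Sum using (_⊎_; inj₁; inj₂)
open import Data.Empty using (⊥-elim)
open import Function using (_∘_; case_of_)
open import Relation.Nullary using (¬_; Dec; yes; no)
open import Relation.Nullary.Decidable using (map′)
open import Relation.Binary.PropositionalEquality
open import Algebra.Structures using (IsCommutativeRing)
open import Relation.Binary.Structures using (IsTotalOrder)
open import Relation.Binary.Bundles using (Poset)
import Relation.Binary.Reasoning.PartialOrder
open import Function.Bundles using (_⇔_; mk⇔; Equivalence)

module _ {ℓ} {A : Set ℓ} where

  -- Equality on χ need not be decidable; among the members of a duplicate-free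
  -- list it is (unique⇒decEqOn), and that is all shortcutting a walk needs.
  DecEqOn : List A → Set ℓ
  DecEqOn xs = ∀ {x y} → x ∈ xs → y ∈ xs → Dec (x ≡ y)

  unique⇒decEqOn : ∀ {xs} → Unique xs → DecEqOn xs
  unique⇒decEqOn (_ ∷ _) (here refl) (here refl) = yes refl
  unique⇒decEqOn (x≢ ∷ _) (here refl) (there y∈) = no (All.lookup x≢ y∈)
  unique⇒decEqOn (x≢ ∷ _) (there x∈) (here refl) = no (All.lookup x≢ x∈ ∘ sym)
  unique⇒decEqOn (_ ∷ u) (there x∈) (there y∈) = unique⇒decEqOn u x∈ y∈

  decEqOn-∷ : ∀ {x xs} → DecEqOn xs → (∀ {y} → y ∈ xs → Dec (x ≡ y)) → DecEqOn (x ∷ xs)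
  decEqOn-∷ _   _    (here refl) (here refl) = yes refl
  decEqOn-∷ _   x≟_  (here refl) (there y∈) = x≟ y∈
  decEqOn-∷ _   x≟_  (there y∈) (here refl) = map′ sym sym (x≟ y∈)
  decEqOn-∷ _≟_ _    (there y∈) (there z∈) = y∈ ≟ z∈

  decEqOn-⊇ : ∀ {xs ys} → DecEqOn ys → (∀ {x} → x ∈ xs → x ∈ ys) → DecEqOn xs
  decEqOn-⊇ _≟_ xs⊆ys x∈ y∈ = xs⊆ys x∈ ≟ xs⊆ys y∈

  ∈-decOn : ∀ {x : A} ys → (∀ {y} → y ∈ ys → Dec (x ≡ y)) → Dec (x ∈ ys)
  ∈-decOn []       _   = no λ ()
  ∈-decOn (y ∷ ys) x≟ with x≟ (here refl) | ∈-decOn ys (x≟ ∘ there)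
  ... | yes x≡y | _      = yes (here x≡y)
  ... | no  _   | yes x∈ = yes (there x∈)
  ... | no  x≢y | no  x∉ = no λ { (here x≡y) → x≢y x≡y ; (there x∈) → x∉ x∈ }

  ∈-∷-++-∷⇔ : ∀ {x a : A} qs rs → x ∈ a ∷ qs ++ a ∷ rs ⇔ (x ∈ a ∷ qs ⊎ x ∈ a ∷ rs)
  ∈-∷-++-∷⇔ {a = a} qs rs = mk⇔ to from
    where
    to : ∀ {x} → x ∈ a ∷ qs ++ a ∷ rs → x ∈ a ∷ qs ⊎ x ∈ a ∷ rs
    to (here x≡a) = inj₁ (here x≡a)
    to (there x∈) = Sum.map₁ there (∈-++⁻ qs x∈)

    from : ∀ {x} → x ∈ a ∷ qs ⊎ x ∈ a ∷ rs → x ∈ a ∷ qs ++ a ∷ rs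
    from (inj₁ (here x≡a)) = here x≡a
    from (inj₁ (there x∈)) = there (∈-++⁺ˡ x∈)
    from (inj₂ x∈)         = there (∈-++⁺ʳ qs x∈)

  record UniqueSublist {p} (P : A → Set p) (ws : List A) : Set (ℓ ⊔ p) where
    field
      list     : List A
      sublist  : list ⊆ ws
      unique   : Unique list
      sound    : ∀ {x} → x ∈ list → P x
      complete : ∀ {x} → x ∈ ws → P x → x ∈ list

  uniqueSublist : ∀ {p} {P : A → Set p} ws → DecEqOn ws → (∀ {x} → x ∈ ws → Dec (P x)) →
                  UniqueSublist P ws
  uniqueSublist [] _ _ = record
    { list = [] ; sublist = [] ; unique = [] ; sound = λ () ; complete = λ () }
  uniqueSublist {P = P} (w ∷ ws) _≟_ P? =
    extend (uniqueSublist ws (λ x∈ y∈ → there x∈ ≟ there y∈) (P? ∘ there))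
           (P? (here refl)) (∈-decOn ws (λ y∈ → here refl ≟ there y∈))
    where
    keep : UniqueSublist P ws → P w → w ∉ ws → UniqueSublist P (w ∷ ws)
    keep S Pw w∉ = record
      { list     = w ∷ list
      ; sublist  = refl ∷ sublist
      ; unique   = All.tabulate (λ x∈ w≡x → w∉ (subst (_∈ ws) (sym w≡x) (lookup sublist x∈))) ∷ unique
      ; sound    = λ { (here refl) → Pw ; (there x∈) → sound x∈ }
      ; complete = λ { (here refl) _ → here refl ; (there x∈) Px → there (complete x∈ Px) }
      }
      where open UniqueSublist S

    skip : UniqueSublist P ws → (P w → w ∈ ws) → UniqueSublist P (w ∷ ws)
    skip S w∈ = record
      { list     = list
      ; sublist  = w ∷ʳ sublist
      ; unique   = unique
      ; sound    = sound
      ; complete = λ { (here refl) Pw → complete (w∈ Pw) Pw ; (there x∈) Px → complete x∈ Px }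
      }
      where open UniqueSublist S

    extend : UniqueSublist P ws → Dec (P w) → Dec (w ∈ ws) → UniqueSublist P (w ∷ ws)
    extend S (yes Pw) (no w∉) = keep S Pw w∉
    extend S (yes _)  (yes w∈) = skip S (λ _ → w∈)
    extend S (no ¬Pw) _        = skip S (⊥-elim ∘ ¬Pw)

module OrderedSum (ℝ : RealField) where
  open RealField ℝ renaming (_≤_ to _≤ᵣ_)
  open IsCommutativeRing isCommutativeRing using (+-comm; +-identityˡ; +-identityʳ)
  open IsTotalOrder isTotalOrder using (antisym) renaming (refl to ≤ᵣ-refl; trans to ≤ᵣ-trans)

  ≤ᵣ-poset : Poset _ _ _
  ≤ᵣ-poset = record { isPartialOrder = IsTotalOrder.isPartialOrder isTotalOrder }

  module ≤ᵣ-Reasoning = Relation.Binary.Reasoning.PartialOrder ≤ᵣ-poset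

  +-mono-≤ : ∀ {x y u v} → x ≤ᵣ y → u ≤ᵣ v → x + u ≤ᵣ y + v
  +-mono-≤ {x} {y} {u} {v} x≤y u≤v =
    ≤ᵣ-trans (+-monoˡ-≤ u x≤y) (subst₂ _≤ᵣ_ (+-comm u y) (+-comm v y) (+-monoˡ-≤ y u≤v))

  x≤x+y : ∀ {x y} → 0# ≤ᵣ y → x ≤ᵣ x + y
  x≤x+y {x} {y} 0≤y = subst (_≤ᵣ x + y) (+-identityʳ x) (+-mono-≤ ≤ᵣ-refl 0≤y)

  +-nonneg : ∀ {x y} → 0# ≤ᵣ x → 0# ≤ᵣ y → 0# ≤ᵣ x + y
  +-nonneg {x} {y} 0≤x 0≤y = subst (_≤ᵣ x + y) (+-identityˡ 0#) (+-mono-≤ 0≤x 0≤y)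

  x+y≡0⇒x≡0 : ∀ {x y} → 0# ≤ᵣ x → 0# ≤ᵣ y → x + y ≡ 0# → x ≡ 0#
  x+y≡0⇒x≡0 0≤x 0≤y x+y≡0 = antisym (subst (_ ≤ᵣ_) x+y≡0 (x≤x+y 0≤y)) 0≤x

module Circuits (ℝ : RealField) {χ : Set} (d : χ → χ → RealField.Carrier ℝ) (metric : IsMetric ℝ d) where
  open RealField ℝ renaming (_≤_ to _≤ᵣ_)
  open IsCommutativeRing isCommutativeRing using (+-assoc; +-comm; +-identityˡ)
  open IsTotalOrder isTotalOrder using () renaming (refl to ≤ᵣ-refl; trans to ≤ᵣ-trans)
  open IsMetric metric using (zero⇔eq) renaming (nonneg to d-nonneg; triangle to d-triangle)
  open OrderedSum ℝ

  cost : List χ → Carrier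
  cost = circuitCost ℝ d

  walk : χ → List χ → χ → Carrier
  walk x []       z = d x z
  walk x (y ∷ ys) z = d x y + walk y ys z

  pathCost+d≡walk : ∀ x ys z → pathCost ℝ d x ys + d (lastOf ℝ d x ys) z ≡ walk x ys z
  pathCost+d≡walk x []       z = +-identityˡ (d x z)
  pathCost+d≡walk x (y ∷ ys) z = trans (+-assoc _ _ _) (cong (d x y +_) (pathCost+d≡walk y ys z))

  cost≡walk : ∀ q qs → cost (q ∷ qs) ≡ walk q qs q
  cost≡walk q qs = pathCost+d≡walk q qs q

  walk-nonneg : ∀ x ys z → 0# ≤ᵣ walk x ys z
  walk-nonneg x []       z = d-nonneg x z
  walk-nonneg x (y ∷ ys) z = +-nonneg (d-nonneg x y) (walk-nonneg y ys z)

  cost-nonneg : ∀ qs → 0# ≤ᵣ cost qs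
  cost-nonneg []       = ≤ᵣ-refl
  cost-nonneg (q ∷ qs) = subst (0# ≤ᵣ_) (sym (cost≡walk q qs)) (walk-nonneg q qs q)

  walk-++ : ∀ x ys y zs z → walk x (ys ++ y ∷ zs) z ≡ walk x ys y + walk y zs z
  walk-++ x []       y zs z = refl
  walk-++ x (u ∷ us) y zs z = trans (cong (d x u +_) (walk-++ u us y zs z)) (sym (+-assoc _ _ _))

  walk-≤-detourˡ : ∀ x y ys z → walk x ys z ≤ᵣ d x y + walk y ys z
  walk-≤-detourˡ x y []       z = d-triangle x y z
  walk-≤-detourˡ x y (u ∷ us) z = begin
    d x u + walk u us z           ≤⟨ +-monoˡ-≤ _ (d-triangle x y u) ⟩
    (d x y + d y u) + walk u us z ≡⟨ +-assoc _ _ _ ⟩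
    d x y + (d y u + walk u us z) ∎
    where open ≤ᵣ-Reasoning

  walk-≤-detourʳ : ∀ x ys y z → walk x ys z ≤ᵣ walk x ys y + d y z
  walk-≤-detourʳ x []       y z = d-triangle x y z
  walk-≤-detourʳ x (u ∷ us) y z = begin
    d x u + walk u us z           ≤⟨ +-mono-≤ ≤ᵣ-refl (walk-≤-detourʳ u us y z) ⟩
    d x u + (walk u us y + d y z) ≡⟨ +-assoc _ _ _ ⟨
    d x u + walk u us y + d y z   ∎
    where open ≤ᵣ-Reasoning

  walk-mono-⊆ : ∀ {ys zs} x z → ys ⊆ zs → walk x ys z ≤ᵣ walk x zs z
  walk-mono-⊆ x z []                     = ≤ᵣ-refl
  walk-mono-⊆ x z (_∷ʳ_ {ys = zs} y ys⊆) = ≤ᵣ-trans (walk-mono-⊆ x z ys⊆) (walk-≤-detourˡ x y zs z)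
  walk-mono-⊆ x z (_∷_ {x = y} refl ys⊆) = +-mono-≤ ≤ᵣ-refl (walk-mono-⊆ y z ys⊆)

  cost-mono-⊆ : ∀ {qs rs} → qs ⊆ rs → cost qs ≤ᵣ cost rs
  cost-mono-⊆ {[]}     {rs}     _ = cost-nonneg rs
  cost-mono-⊆ {q ∷ qs} {r ∷ rs} (refl ∷ qs⊆) = begin
    cost (q ∷ qs) ≡⟨ cost≡walk q qs ⟩
    walk q qs q   ≤⟨ walk-mono-⊆ q q qs⊆ ⟩
    walk q rs q   ≡⟨ cost≡walk q rs ⟨
    cost (q ∷ rs) ∎
    where open ≤ᵣ-Reasoning
  cost-mono-⊆ {q ∷ qs} {r ∷ rs} (.r ∷ʳ q∷qs⊆) = begin
    cost (q ∷ qs)         ≡⟨ cost≡walk q qs ⟩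
    walk q qs q           ≤⟨ walk-≤-detourʳ q qs r q ⟩
    walk q qs r + d r q   ≡⟨ +-comm _ _ ⟩
    walk r (q ∷ qs) r     ≤⟨ walk-mono-⊆ r r q∷qs⊆ ⟩
    walk r rs r           ≡⟨ cost≡walk r rs ⟨
    cost (r ∷ rs)         ∎
    where open ≤ᵣ-Reasoning

  cost-++-comm : ∀ qs rs → cost (qs ++ rs) ≡ cost (rs ++ qs)
  cost-++-comm []       rs       = cong cost (sym (++-identityʳ rs))
  cost-++-comm (q ∷ qs) []       = cong cost (++-identityʳ (q ∷ qs))
  cost-++-comm (q ∷ qs) (r ∷ rs) = begin
    cost (q ∷ qs ++ r ∷ rs)   ≡⟨ cost≡walk q (qs ++ r ∷ rs) ⟩
    walk q (qs ++ r ∷ rs) q   ≡⟨ walk-++ q qs r rs q ⟩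
    walk q qs r + walk r rs q ≡⟨ +-comm _ _ ⟩
    walk r rs q + walk q qs r ≡⟨ walk-++ r rs q qs r ⟨
    walk r (rs ++ q ∷ qs) r   ≡⟨ cost≡walk r (rs ++ q ∷ qs) ⟨
    cost (r ∷ rs ++ q ∷ qs)   ∎
    where open ≡-Reasoning

  rotateTo : ∀ {a qs} → a ∈ qs → ∃[ rs ] (qs ↭ a ∷ rs × cost (a ∷ rs) ≡ cost qs)
  rotateTo {a} a∈qs with us , vs , refl ← ∈-∃++ a∈qs =
    vs ++ us , ++-comm us (a ∷ vs) , cost-++-comm (a ∷ vs) us

  cost-glue : ∀ a qs rs → cost (a ∷ qs ++ a ∷ rs) ≡ cost (a ∷ qs) + cost (a ∷ rs)
  cost-glue a qs rs = begin
    cost (a ∷ qs ++ a ∷ rs)   ≡⟨ cost≡walk a (qs ++ a ∷ rs) ⟩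
    walk a (qs ++ a ∷ rs) a   ≡⟨ walk-++ a qs a rs a ⟩
    walk a qs a + walk a rs a ≡⟨ cong₂ _+_ (cost≡walk a qs) (cost≡walk a rs) ⟨
    cost (a ∷ qs) + cost (a ∷ rs) ∎
    where open ≡-Reasoning

  joinAt : ∀ {a qs rs} → a ∈ qs → a ∈ rs →
           ∃[ ws ] (cost ws ≡ cost qs + cost rs × (∀ {x} → x ∈ ws ⇔ (x ∈ qs ⊎ x ∈ rs)))
  joinAt {a} a∈qs a∈rs
    with qs′ , qs↭ , cost-qs′ ← rotateTo a∈qs
       | rs′ , rs↭ , cost-rs′ ← rotateTo a∈rs
    = a ∷ qs′ ++ a ∷ rs′
    , trans (cost-glue a qs′ rs′) (cong₂ _+_ cost-qs′ cost-rs′)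
    , mk⇔ (Sum.map (∈-resp-↭ (↭-sym qs↭)) (∈-resp-↭ (↭-sym rs↭)) ∘ Equivalence.to (∈-∷-++-∷⇔ qs′ rs′))
          (Equivalence.from (∈-∷-++-∷⇔ qs′ rs′) ∘ Sum.map (∈-resp-↭ qs↭) (∈-resp-↭ rs↭))

  cost≡0⇔constant : ∀ {qs} → Unique qs →
                    (cost qs ≡ 0#) ⇔ (∀ {x y} → x ∈ qs → y ∈ qs → x ≡ y)
  cost≡0⇔constant {qs} unique = mk⇔ (to qs unique) (from qs unique)
    where
    d≡0⇒≡ : ∀ {x y} → d x y ≡ 0# → x ≡ y
    d≡0⇒≡ = Equivalence.to (zero⇔eq _ _)

    to : ∀ qs → Unique qs → cost qs ≡ 0# → ∀ {x y} → x ∈ qs → y ∈ qs → x ≡ y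
    to (q ∷ [])     _          _  (here refl) (here refl) = refl
    to (q ∷ r ∷ rs) (q∉ ∷ _) c≡0 _           _           =
      ⊥-elim (All.lookup q∉ (here refl)
        (d≡0⇒≡ (x+y≡0⇒x≡0 (d-nonneg q r) (walk-nonneg r rs q) (trans (sym (cost≡walk q (r ∷ rs))) c≡0))))

    from : ∀ qs → Unique qs → (∀ {x y} → x ∈ qs → y ∈ qs → x ≡ y) → cost qs ≡ 0#
    from []           _          _     = refl
    from (q ∷ [])     _          _     = trans (+-identityˡ _) (Equivalence.from (zero⇔eq q q) refl)
    from (q ∷ r ∷ rs) (q∉ ∷ _) const =
      ⊥-elim (All.lookup q∉ (here refl) (const (here refl) (there (here refl))))

module _ (ℝ : RealField) {χ : Set} {k : ℕ} (i : ℕ) (p : Fin k → χ) (a : χ) (j : Fin k) where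

  prefixThen-< : toℕ j < i → prefixThen ℝ i p a j ≡ p j
  prefixThen-< j<i with toℕ j <? i
  ... | yes _   = refl
  ... | no  j≮i = ⊥-elim (j≮i j<i)

  prefixThen-≮ : ¬ toℕ j < i → prefixThen ℝ i p a j ≡ a
  prefixThen-≮ j≮i with toℕ j <? i
  ... | yes j<i = ⊥-elim (j≮i j<i)
  ... | no  _   = refl

  thenSuffix-< : toℕ j < i → thenSuffix ℝ i a p j ≡ a
  thenSuffix-< j<i with toℕ j <? i
  ... | yes _   = refl
  ... | no  j≮i = ⊥-elim (j≮i j<i)

  thenSuffix-≮ : ¬ toℕ j < i → thenSuffix ℝ i a p j ≡ p j
  thenSuffix-≮ j≮i with toℕ j <? i
  ... | yes j<i = ⊥-elim (j≮i j<i)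
  ... | no  _   = refl

module HamiltonianCircuitMetric
  (ℝ : RealField) {χ : Set} (d : χ → χ → RealField.Carrier ℝ) (metric : IsMetric ℝ d)
  {k : ℕ} (dHC : (Fin k → χ) → RealField.Carrier ℝ) (isMinHC : ∀ p → IsMinHC ℝ d p (dHC p))
  where
  open RealField ℝ using (0#; _+_; isTotalOrder) renaming (_≤_ to _≤ᵣ_)
  open IsTotalOrder isTotalOrder using (antisym) renaming (trans to ≤ᵣ-trans)
  open OrderedSum ℝ
  open Circuits ℝ d metric

  _∈ₑ_ : χ → (Fin k → χ) → Set
  x ∈ₑ p = ∃[ j ] (p j ≡ x)

  tour : (Fin k → χ) → List χ
  tour p = proj₁ (proj₁ (isMinHC p))

  tour-unique : ∀ p → Unique (tour p)
  tour-unique p = proj₁ (proj₁ (proj₂ (proj₁ (isMinHC p))))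

  ∈tour⇔∈ₑ : ∀ p {x} → x ∈ tour p ⇔ x ∈ₑ p
  ∈tour⇔∈ₑ p {x} = proj₂ (proj₁ (proj₂ (proj₁ (isMinHC p)))) x

  cost-tour : ∀ p → cost (tour p) ≡ dHC p
  cost-tour p = proj₂ (proj₂ (proj₁ (isMinHC p)))

  dHC-minimal : ∀ p {qs} → IsOrderingOf ℝ d p qs → dHC p ≤ᵣ cost qs
  dHC-minimal p = proj₂ (isMinHC p) _

  ∈-tour : ∀ p j → p j ∈ tour p
  ∈-tour p j = Equivalence.from (∈tour⇔∈ₑ p) (j , refl)

  tour-⊆ : ∀ p {ws} → (∀ j → p j ∈ ws) → ∀ {x} → x ∈ tour p → x ∈ ws
  tour-⊆ p covers x∈ with j , refl ← Equivalence.to (∈tour⇔∈ₑ p) x∈ = covers j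

  dHC-≤-cost : ∀ p {ws} → DecEqOn ws → (∀ j → p j ∈ ws) → dHC p ≤ᵣ cost ws
  dHC-≤-cost p {ws} _≟_ covers = ≤ᵣ-trans (dHC-minimal p isOrdering) (cost-mono-⊆ sublist)
    where
    _∈ₑp? : ∀ {x} → x ∈ ws → Dec (x ∈ₑ p)
    x∈ ∈ₑp? = map′ (Equivalence.to (∈tour⇔∈ₑ p)) (Equivalence.from (∈tour⇔∈ₑ p))
                   (∈-decOn (tour p) λ y∈ → x∈ ≟ tour-⊆ p covers y∈)

    open UniqueSublist (uniqueSublist ws _≟_ _∈ₑp?)

    isOrdering : IsOrderingOf ℝ d p list
    isOrdering = unique , λ x → mk⇔ sound λ { (j , refl) → complete (covers j) (j , refl) }

  dHC-mono : ∀ {p p'} → _⊆ₑ_ ℝ p p' → dHC p ≤ᵣ dHC p'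
  dHC-mono {p} {p'} p⊆p' = subst (dHC p ≤ᵣ_) (cost-tour p')
    (dHC-≤-cost p (unique⇒decEqOn (tour-unique p'))
                  (λ j → Equivalence.from (∈tour⇔∈ₑ p') (p⊆p' (p j) (j , refl))))

  dHC-nonneg : ∀ p → 0# ≤ᵣ dHC p
  dHC-nonneg p = subst (0# ≤ᵣ_) (cost-tour p) (cost-nonneg (tour p))

  dHC-perm : ∀ (π : Permutation′ k) p → dHC p ≡ dHC (λ j → p (π ⟨$⟩ʳ j))
  dHC-perm π p = antisym
    (dHC-mono λ { x (j , refl) → π ⟨$⟩ˡ j , cong p (inverseʳ π) })
    (dHC-mono λ { x (j , refl) → π ⟨$⟩ʳ j , refl })

  dHC≡0⇔constant : ∀ p → (dHC p ≡ 0#) ⇔ (∀ i j → p i ≡ p j)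
  dHC≡0⇔constant p = mk⇔
    (λ dHC≡0 i j → Equivalence.to tour-cost≡0⇔ (trans (cost-tour p) dHC≡0) (∈-tour p i) (∈-tour p j))
    (λ const → trans (sym (cost-tour p)) (Equivalence.from tour-cost≡0⇔ λ x∈ y∈ →
      tourConstant const (Equivalence.to (∈tour⇔∈ₑ p) x∈) (Equivalence.to (∈tour⇔∈ₑ p) y∈)))
    where
    tour-cost≡0⇔ : (cost (tour p) ≡ 0#) ⇔ (∀ {x y} → x ∈ tour p → y ∈ tour p → x ≡ y)
    tour-cost≡0⇔ = cost≡0⇔constant (tour-unique p)

    tourConstant : (∀ i j → p i ≡ p j) → ∀ {x y} → x ∈ₑ p → y ∈ₑ p → x ≡ y
    tourConstant const (i , refl) (j , refl) = const i j

  module _ (p : Fin k → χ) (a : χ) (i : ℕ) where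
    private
      pre suf : Fin k → χ
      pre = prefixThen ℝ i p a
      suf = thenSuffix ℝ i a p

    dHC-triangle-≡ : i ≡ k → dHC p ≤ᵣ dHC pre + dHC suf
    dHC-triangle-≡ refl = ≤ᵣ-trans
      (dHC-mono λ { x (j , refl) → j , prefixThen-< ℝ i p a j (toℕ<n j) })
      (x≤x+y (dHC-nonneg suf))

    ∈-tour-prefixThen⊎thenSuffix : ∀ j → p j ∈ tour pre ⊎ p j ∈ tour suf
    ∈-tour-prefixThen⊎thenSuffix j with toℕ j <? i
    ... | yes j<i = inj₁ (subst (_∈ tour pre) (prefixThen-< ℝ i p a j j<i) (∈-tour pre j))
    ... | no  j≮i = inj₂ (subst (_∈ tour suf) (thenSuffix-≮ ℝ i p a j j≮i) (∈-tour suf j))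

    tour-prefixThen⊆ : ∀ {x} → x ∈ tour pre → x ∈ a ∷ tour p
    tour-prefixThen⊆ = tour-⊆ pre λ j → case toℕ j <? i of λ where
      (yes j<i) → there (subst (_∈ tour p) (sym (prefixThen-< ℝ i p a j j<i)) (∈-tour p j))
      (no  j≮i) → here (prefixThen-≮ ℝ i p a j j≮i)

    tour-thenSuffix⊆ : ∀ {x} → x ∈ tour suf → x ∈ a ∷ tour p
    tour-thenSuffix⊆ = tour-⊆ suf λ j → case toℕ j <? i of λ where
      (yes j<i) → here (thenSuffix-< ℝ i p a j j<i)
      (no  j≮i) → there (subst (_∈ tour p) (sym (thenSuffix-≮ ℝ i p a j j≮i)) (∈-tour p j))

    a∈tour-prefixThen : i < k → a ∈ tour pre
    a∈tour-prefixThen i<k = subst (_∈ tour pre)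
      (prefixThen-≮ ℝ i p a (fromℕ< i<k) (<-irrefl (toℕ-fromℕ< i<k)))
      (∈-tour pre (fromℕ< i<k))

    a∈tour-thenSuffix : 1 ≤ i → i < k → a ∈ tour suf
    a∈tour-thenSuffix 1≤i i<k = subst (_∈ tour suf)
      (thenSuffix-< ℝ i p a (fromℕ< 0<k) (subst (_< i) (sym (toℕ-fromℕ< 0<k)) 1≤i))
      (∈-tour suf (fromℕ< 0<k))
      where
      0<k : 0 < k
      0<k = <-≤-trans 1≤i (<⇒≤ i<k)

    decEqOn-a∷tour : 1 ≤ i → i < k → DecEqOn (a ∷ tour p)
    decEqOn-a∷tour 1≤i i<k = decEqOn-∷ (unique⇒decEqOn (tour-unique p)) a≟
      where
      a≟ : ∀ {y} → y ∈ tour p → Dec (a ≡ y)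
      a≟ y∈ with j , refl ← Equivalence.to (∈tour⇔∈ₑ p) y∈ with ∈-tour-prefixThen⊎thenSuffix j
      ... | inj₁ ∈pre = unique⇒decEqOn (tour-unique pre) (a∈tour-prefixThen i<k) ∈pre
      ... | inj₂ ∈suf = unique⇒decEqOn (tour-unique suf) (a∈tour-thenSuffix 1≤i i<k) ∈suf

    dHC-triangle-< : 1 ≤ i → i < k → dHC p ≤ᵣ dHC pre + dHC suf
    dHC-triangle-< 1≤i i<k
      with ws , cost-ws , ∈ws⇔ ← joinAt (a∈tour-prefixThen i<k) (a∈tour-thenSuffix 1≤i i<k) = begin
      dHC p                             ≤⟨ dHC-≤-cost p decEqOn-ws covers ⟩
      cost ws                           ≡⟨ cost-ws ⟩
      cost (tour pre) + cost (tour suf) ≡⟨ cong₂ _+_ (cost-tour pre) (cost-tour suf) ⟩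
      dHC pre + dHC suf                 ∎
      where
      open ≤ᵣ-Reasoning

      covers : ∀ j → p j ∈ ws
      covers j = Equivalence.from ∈ws⇔ (∈-tour-prefixThen⊎thenSuffix j)

      decEqOn-ws : DecEqOn ws
      decEqOn-ws = decEqOn-⊇ (decEqOn-a∷tour 1≤i i<k)
        (Sum.[ tour-prefixThen⊆ , tour-thenSuffix⊆ ] ∘ Equivalence.to ∈ws⇔)

    dHC-triangle : 1 ≤ i → i ≤ k → dHC p ≤ᵣ dHC pre + dHC suf
    dHC-triangle 1≤i i≤k with m≤n⇒m<n∨m≡n i≤k
    ... | inj₁ i<k = dHC-triangle-< 1≤i i<k
    ... | inj₂ i≡k = dHC-triangle-≡ i≡k

proposition2 : (ℝ : RealField) {χ : Set} (k : ℕ) → 2 ≤ k →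
    (d : χ → χ → RealField.Carrier ℝ) → IsMetric ℝ d →
    (dHC : (Fin k → χ) → RealField.Carrier ℝ) →
    (∀ p → IsMinHC ℝ d p (dHC p)) →
    IsHMetric ℝ k 1 dHC
proposition2 ℝ k 2≤k d metric dHC isMinHC = record
  { γ≤k-1    = ∸-monoˡ-≤ 1 2≤k
  ; perm     = dHC-perm
  ; nonneg   = dHC-nonneg
  ; zero⇔eq  = dHC≡0⇔constant
  ; triangle = dHC-triangle
  ; mono⊂    = λ _ _ → dHC-mono ∘ proj₁
  ; mono≡    = λ p p' p⊆p' _ → subst (dHC p ≤ᵣ_) (sym (+-identityʳ (dHC p'))) (dHC-mono p⊆p')
  }
  where
  open HamiltonianCircuitMetric ℝ d metric dHC isMinHC
  open RealField ℝ using (isCommutativeRing) renaming (_≤_ to _≤ᵣ_)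
  open IsCommutativeRing isCommutativeRing using (+-identityʳ)
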